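{- Let $Q\in\mathrm{QPD}(w)$. Then \[ \mathcal G_Q^{(\beta)}=\sum_{P\in\mathrm{int}(\widetilde\Delta(\mathcal Q_{0,n}, \mathrm{word}(Q)))} \beta^{\mathrm{codim}(P)}\mathbf x^P, \] where $\mathbf x^P$ denotes the monomial of the pipe dream corresponding to the face $P$.
   Context: Pipe dreams: $n\times n$ squares filled with crosses and elbows, crosses strictly above the antidiagonal; reduced if each pair of strands crosses at most once; $\mathrm{reduct}(P)$ replaces repeated crossings by elbows; the shape of $P$ is the permutation of $\mathrm{reduct}(P)$; $\mathrm{PD}(w)$ is the set of pipe dreams of shape $w\in\mathbf S_n$. For a pipe dream $P$ with set of cross coordinates $D_P$, $\mathbf x^P=\prod_{(i,j)\in D_P}x_i$ and $\mathrm{ex}(P)=\#(D_P\smallsetminus D_{\mathrm{reduct}(P)})$. Slide move $S_i$: if the leftmost cross in row $i$ is not in column 1 and lies strictly right of the rightmost cross in row $i+1$, move it one step southwest (merging with a cross already there); otherwise identity. $\mathrm{QPD}(w)$ is the set of quasi-Yamanouchi pipe dreams of shape $w$ (all $S_i$ act identically). $\mathrm{dst}:\mathrm{PD}(w)\to\mathrm{QPD}(w)$ applies slide moves until quasi-Yamanouchi. The glide polynomial is $\mathcal G^{(\beta)}_Q=\sum_{P\in\mathrm{dst}^{ -1}(Q)}\beta^{\mathrm{ex}(P)-\mathrm{ex}(Q)}\mathbf x^P$. $\mathcal Q_{0,n}=(s_{n-1}\dots s_1)(s_{n-1}\dots s_2)\dots(s_{n-1})$, read from the staircase table with $s_{i+j-1}$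 in cell $(i,j)$ (right to left, top to bottom); $\mathrm{word}(P)$ is the subword given by the cells of crosses of $P$, and faces $\mathcal Q_{0,n}\smallsetminus\mathrm{word}(P)$ are identified with pipe dreams $P$. The slide complex $\widetilde\Delta(\mathcal Q,\mathcal S)$ is the simplicial complex of subwords $\mathcal Q\smallsetminus\mathcal P$ whose complement $\mathcal P$ contains $\mathcal S$ as a subword; its interior faces are those with $\widetilde\delta(\mathcal P)=\mathcal S$, where $\widetilde\delta$ collapses runs of identical consecutive letters. The interior faces of $\widetilde\Delta(\mathcal Q_{0,n},\mathrm{word}(Q))$ correspond bijectively to the glide orbit $\mathrm{dst}^{ -1}(Q)$; $\mathrm{codim}(P)$ is the codimension of the face in this complex. -}

module Defs where

open import Data.Bool using (Bool; true; false; if_then_else_; not; _∧_; _∨_)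
open import Data.Nat using (ℕ; zero; suc; _+_; _*_; _∸_; _≡ᵇ_; _<ᵇ_; _≤ᵇ_)
import Data.Nat as ℕ
open import Data.Integer using (ℤ; +_; _-_)
import Data.Integer as ℤ
open import Data.List using (List; []; _∷_; map; length; upTo; downFrom; concatMap; filterᵇ; foldr)
import Data.List.Properties as Lₚ
open import Data.Vec using (Vec)
import Data.Vec as Vec
import Data.Vec.Properties as Vₚ
open import Data.Maybe using (Maybe; just; nothing)
open import Data.Product using (_×_; _,_; proj₁; proj₂)
import Data.Product.Properties as ×ₚ
import Data.Bool as Bool
open import Relation.Nullary using (does)
open import Relation.Binary.PropositionalEquality using (_≡_)

Cell : Set
Cell = ℕ × ℕ   -- (row i, column j), 1-indexed

-- Cells (i,j) with i + j ≤ n (strictly above the antidiagonal), in the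
-- reading order of Q_{0,n}: rows i = 1..n-1 top to bottom, and within a
-- row the columns j = n-i, ..., 1 (right to left).
cells : ℕ → List Cell
cells n = concatMap (λ i → map (λ j → (i , j)) (map suc (downFrom (n ∸ i))))
                    (map suc (upTo (n ∸ 1)))

size : ℕ → ℕ
size n = length (cells n)

cellsV : (n : ℕ) → Vec Cell (size n)
cellsV n = Vec.fromList (cells n)

-- the letter s_{i+j-1} of Q_{0,n} sitting in cell (i,j) (we record i+j-1)
letter : Cell → ℕ
letter (i , j) = i + j ∸ 1

-- Pipe dreams: a Boolean for each cell of the staircase (true = cross).
-- Equivalently a subset of the positions of the word Q_{0,n}.

-- (wrapped in a record so that n can be inferred)
record PipeDream (n : ℕ) : Set where
  constructor pd
  field
    marks : Vec Bool (size n)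
open PipeDream public

_==ᶜ_ : Cell → Cell → Bool
(a , b) ==ᶜ (c , d) = (a ≡ᵇ c) ∧ (b ≡ᵇ d)

memᶜ : Cell → List Cell → Bool
memᶜ c = foldr (λ d r → (c ==ᶜ d) ∨ r) false

crosses : {n : ℕ} → PipeDream n → List Cell
crosses {n} P =
  map proj₁ (filterᵇ proj₂ (Vec.toList (Vec.zip (cellsV n) (marks P))))

fromCells : (n : ℕ) → List Cell → PipeDream n
fromCells n D = pd (Vec.map (λ c → memᶜ c D) (cellsV n))

word : {n : ℕ} → PipeDream n → List ℕ
word P = map letter (crosses P)

-- Permutations in one-line notation, as lists; s_a (a ≥ 1) acting on the
-- right swaps the entries in positions a and a+1.

idPerm : ℕ → List ℕ
idPerm n = map suc (upTo n)

at : List ℕ → ℕ → ℕ          -- 0-indexed lookup, default 0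
at []       _       = 0
at (x ∷ xs) zero    = x
at (x ∷ xs) (suc k) = at xs k

swapAt : ℕ → List ℕ → List ℕ  -- swap 0-indexed positions k, k+1
swapAt zero    (x ∷ y ∷ xs) = y ∷ x ∷ xs
swapAt zero    xs           = xs
swapAt (suc k) []           = []
swapAt (suc k) (x ∷ xs)     = x ∷ swapAt k xs

rmul : List ℕ → ℕ → List ℕ
rmul w a = swapAt (a ∸ 1) w

-- ℓ(w s_a) > ℓ(w)
ascent : List ℕ → ℕ → Bool
ascent w a = at w (a ∸ 1) <ᵇ at w a

wordPerm : List ℕ → List ℕ → List ℕ
wordPerm w []       = w
wordPerm w (a ∷ as) = wordPerm (rmul w a) as

-- Scan the crosses in reading order; a cross is kept iff the two strands
-- meeting there have not crossed before (i.e. it is an ascent of the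
-- permutation built so far); otherwise it is replaced by an elbow.
keptCells : List ℕ → List Cell → List Cell
keptCells w []       = []
keptCells w (c ∷ cs) =
  if ascent w (letter c)
  then c ∷ keptCells (rmul w (letter c)) cs
  else keptCells w cs

reduct : {n : ℕ} → PipeDream n → PipeDream n
reduct {n} P = fromCells n (keptCells (idPerm n) (crosses P))

perm : {n : ℕ} → PipeDream n → List ℕ
perm {n} P = wordPerm (idPerm n) (word P)

shape : {n : ℕ} → PipeDream n → List ℕ
shape P = perm (reduct P)

ex : {n : ℕ} → PipeDream n → ℕ
ex P = length (filterᵇ (λ c → not (memᶜ c (crosses (reduct P)))) (crosses P))

rowCols : List Cell → ℕ → List ℕ
rowCols D i = map proj₂ (filterᵇ (λ c → proj₁ c ≡ᵇ i) D)

minM : List ℕ → Maybe ℕ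
minM []       = nothing
minM (x ∷ xs) with minM xs
... | nothing = just x
... | just y  = just (ℕ._⊓_ x y)

maxM : List ℕ → Maybe ℕ
maxM []       = nothing
maxM (x ∷ xs) with maxM xs
... | nothing = just x
... | just y  = just (ℕ._⊔_ x y)

-- "j lies strictly right of the rightmost cross in row i+1"
-- (vacuously true if row i+1 has no cross)
rightOf : Maybe ℕ → ℕ → Bool
rightOf nothing  j = true
rightOf (just m) j = m <ᵇ j

slide : {n : ℕ} → ℕ → PipeDream n → PipeDream n
slide {n} i P with minM (rowCols (crosses P) i)
... | nothing = P
... | just j  =
  if (2 ≤ᵇ j) ∧ rightOf (maxM (rowCols (crosses P) (suc i))) j
  then fromCells n ((suc i , j ∸ 1) ∷ filterᵇ (λ c → not (c ==ᶜ (i , j))) (crosses P))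
  else P

≡ᵖ? : {n : ℕ} → PipeDream n → PipeDream n → Bool
≡ᵖ? P R = does (Vₚ.≡-dec Bool._≟_ (marks P) (marks R))

QuasiYamanouchi : {n : ℕ} → PipeDream n → Set
QuasiYamanouchi {n} P = (i : ℕ) → 1 ℕ.≤ i → i ℕ.< n → slide i P ≡ P

firstSlide : {n : ℕ} → List ℕ → PipeDream n → Maybe (PipeDream n)
firstSlide []       P = nothing
firstSlide (i ∷ is) P =
  if ≡ᵖ? (slide i P) P then firstSlide is P else just (slide i P)

dstFuel : {n : ℕ} → ℕ → PipeDream n → PipeDream n
dstFuel zero    P = P
dstFuel {n} (suc k) P with firstSlide (map suc (upTo (n ∸ 1))) P
... | nothing = P
... | just R  = dstFuel k R

-- Each nontrivial slide lowers the sum of the column indices of the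
-- crosses by ≥ 1, and that sum is ≤ size n * n, so this fuel suffices to
-- reach a quasi-Yamanouchi pipe dream.
dst : {n : ℕ} → PipeDream n → PipeDream n
dst {n} P = dstFuel (suc (size n * n)) P

allVecs : (m : ℕ) → List (Vec Bool m)
allVecs zero    = Vec.[] ∷ []
allVecs (suc m) = concatMap (λ v → (true Vec.∷ v) ∷ (false Vec.∷ v) ∷ []) (allVecs m)

allPD : (n : ℕ) → List (PipeDream n)
allPD n = map pd (allVecs (size n))

-- A monomial β^k x_1^{e_1} ... x_n^{e_n}, stored as (k , [e_1,...,e_n]).
-- (k ∈ ℤ, so no truncation can hide negative exponents.)
Monomial : Set
Monomial = ℤ × List ℕ

-- A polynomial with coefficients in ℕ, written as a formal sum of monomials.
Poly : Set
Poly = List Monomial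

_≟ₘ_ : (a b : Monomial) → Bool
a ≟ₘ b = does (×ₚ.≡-dec ℤ._≟_ (Lₚ.≡-dec ℕ._≟_) a b)

coeff : Poly → Monomial → ℕ
coeff p m = length (filterᵇ (λ m' → m ≟ₘ m') p)

_≈ₚ_ : Poly → Poly → Set
p ≈ₚ q = (m : Monomial) → coeff p m ≡ coeff q m

-- exponent vector of x^P = ∏_{(i,j) ∈ D_P} x_i
xExp : {n : ℕ} → PipeDream n → List ℕ
xExp {n} P = map (λ i → length (rowCols (crosses P) i)) (map suc (upTo n))

inGlideOrbit : {n : ℕ} → List ℕ → PipeDream n → PipeDream n → Bool
inGlideOrbit w Q P = does (Lₚ.≡-dec ℕ._≟_ (shape P) w) ∧ ≡ᵖ? (dst P) Q

glide : (n : ℕ) → List ℕ → PipeDream n → Poly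
glide n w Q =
  map (λ P → ((+ ex P) - (+ ex Q)) , xExp P) (filterᵇ (inGlideOrbit w Q) (allPD n))

-- Slide complex Δ̃(Q_{0,n}, S); a face Q_{0,n} ∖ P is identified with the
-- pipe dream P (its complement).

isSubword : List ℕ → List ℕ → Bool
isSubword []       _        = true
isSubword (s ∷ ss) []       = false
isSubword (s ∷ ss) (x ∷ xs) =
  if s ≡ᵇ x then isSubword ss xs else isSubword (s ∷ ss) xs

-- δ̃ : collapse runs of identical consecutive letters
collapse : List ℕ → List ℕ
collapse []       = []
collapse (x ∷ xs) with collapse xs
... | []     = x ∷ []
... | y ∷ ys = if x ≡ᵇ y then y ∷ ys else x ∷ y ∷ ys

isFace : {n : ℕ} → List ℕ → PipeDream n → Bool
isFace S P = isSubword S (word P)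

-- Q_{0,n} ∖ P is an interior face: δ̃(P) = S
isInterior : {n : ℕ} → List ℕ → PipeDream n → Bool
isInterior S P = does (Lₚ.≡-dec ℕ._≟_ (collapse (word P)) S)

faceSize : {n : ℕ} → PipeDream n → ℕ
faceSize {n} P = size n ∸ length (crosses P)

-- 1 + dimension of the complex = largest size of a face
maxFaceSize : (n : ℕ) → List ℕ → ℕ
maxFaceSize n S = foldr ℕ._⊔_ 0 (map faceSize (filterᵇ (isFace S) (allPD n)))

codim : {n : ℕ} → List ℕ → PipeDream n → ℕ
codim {n} S P = maxFaceSize n S ∸ faceSize P

interiorSum : (n : ℕ) → PipeDream n → Poly
interiorSum n Q =
  map (λ P → (+ codim (word Q) P) , xExp P)
      (filterᵇ (isInterior (word Q)) (allPD n))

-- A slide move either moves a cross one step southwest or merges it into the cross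
-- already there.  Either way the word of the pipe dream is unchanged up to collapsing
-- runs of equal letters, while the sum of the column indices of the crosses drops; so
-- dst P is quasi-Yamanouchi and has the collapsed word of P.  In a quasi-Yamanouchi
-- pipe dream every cross is kept from sliding by the cross read after it, which forces
-- consecutive letters of the word to differ and lets the word determine the pipe
-- dream.  Hence P lies in the glide orbit of Q exactly when collapsing word P gives
-- word Q, i.e. when Q_{0,n} ∖ P is an interior face.  The reduct only sees the
-- collapsed word, so such P has the shape of Q and ex P − ex Q = #D_P − #D_Q, which
-- is the codimension of the face because the largest faces are those of size
-- #Q_{0,n} − #D_Q.

module Submission where

open import Defs
open import Data.Bool using (Bool; true; false; if_then_else_; not; _∧_; _∨_; T)
open import Data.Bool.Properties using (T-∧; T-∨; T-≡; ¬-not)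
open import Data.Nat using (ℕ; zero; suc; _+_; _*_; _∸_; _≡ᵇ_; _<ᵇ_; _≤ᵇ_; _≤_; _<_; _>_; z≤n; s≤s; s≤s⁻¹; _⊔_)
open import Data.Nat.Properties
open import Data.List using (List; []; _∷_; map; length; upTo; downFrom; concatMap; filterᵇ; _++_)
open import Data.List.Properties using (map-++; length-map; ∷-injectiveˡ; ∷-injectiveʳ)
import Data.List.Properties as Lₚ
open import Data.List.Membership.Propositional using (_∈_; _∉_)
open import Data.List.Membership.Propositional.Properties
open import Data.List.Relation.Unary.Any as Any using (here; there)
open import Data.List.Relation.Unary.All as All using (All; []; _∷_)
open import Data.List.Relation.Unary.AllPairs using (AllPairs; []; _∷_)
import Data.List.Relation.Unary.AllPairs.Properties as AllPairs
open import Data.Product using (_×_; _,_; proj₁; proj₂; ∃-syntax)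
open import Data.Product.Properties using () renaming (≡-dec to ×-≡-dec)
open import Data.Product.Relation.Binary.Lex.Strict using (×-Lex; ×-transitive)
import Data.Integer as ℤ
import Data.Integer.Properties as ℤ
open import Data.Sum using (_⊎_; inj₁; inj₂)
open import Data.Empty using (⊥-elim)
open import Data.Unit using (⊤; tt)
open import Data.Maybe using (just; nothing)
open import Data.Vec using (Vec)
import Data.Vec as Vec
import Data.Vec.Properties as Vec
import Data.Bool as Bool
open import Function using (id; _∘_; flip)
open import Function.Bundles using (Equivalence)
open import Relation.Nullary using (¬_; Dec; yes; no; does)
open import Relation.Nullary.Decidable using (T?; dec-true)
open import Relation.Binary.PropositionalEquality

_≺_ : Cell → Cell → Set
_≺_ = ×-Lex _≡_ _<_ _>_

≺-trans : ∀ {x y z} → x ≺ y → y ≺ z → x ≺ z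
≺-trans = ×-transitive {_≈₁_ = _≡_} {_<₁_ = _<_} {_<₂_ = _>_}
  isEquivalence (resp₂ _<_) <-trans (flip <-trans)

≺-irrefl : ∀ {x} → ¬ (x ≺ x)
≺-irrefl (inj₁ p)       = <-irrefl refl p
≺-irrefl (inj₂ (_ , p)) = <-irrefl refl p

≺-asym : ∀ {x y} → x ≺ y → ¬ (y ≺ x)
≺-asym p q = ≺-irrefl (≺-trans p q)

≺⇒≢ : ∀ {x y} → x ≺ y → x ≢ y
≺⇒≢ p refl = ≺-irrefl p

Sorted : List Cell → Set
Sorted = AllPairs _≺_

InStaircase : ℕ → Cell → Set
InStaircase n (i , j) = 1 ≤ i × 1 ≤ j × i + j ≤ n

row : ℕ → ℕ → List Cell
row i k = map (i ,_) (map suc (downFrom k))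

rowCells : ℕ → ℕ → List Cell
rowCells n i = row i (n ∸ i)

rows : ℕ → List ℕ
rows n = map suc (upTo (n ∸ 1))

+-suc-≤⇒<∸ : ∀ i j n → i + suc j ≤ n → j < n ∸ i
+-suc-≤⇒<∸ zero    j n       p       = p
+-suc-≤⇒<∸ (suc i) j (suc n) (s≤s p) = +-suc-≤⇒<∸ i j n p

<∸⇒+-suc-≤ : ∀ i j n → j < n ∸ i → i + suc j ≤ n
<∸⇒+-suc-≤ zero    j n       p = p
<∸⇒+-suc-≤ (suc i) j (suc n) p = s≤s (<∸⇒+-suc-≤ i j n p)

∈rows : ∀ {n i} → suc i < n → suc i ∈ rows n
∈rows {suc n} (s≤s i<n) = ∈-map⁺ suc (∈-upTo⁺ i<n)

∈row : ∀ i k {c} → c ∈ row i k → ∃[ j ] (j < k × c ≡ (i , suc j))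
∈row i k p with ∈-map⁻ (i ,_) p
... | _ , d∈ , refl with ∈-map⁻ suc d∈
... | j , j∈ , refl = j , ∈-downFrom⁻ j∈ , refl

∈cells⇒InStaircase : ∀ n {c} → c ∈ cells n → InStaircase n c
∈cells⇒InStaircase n p with ∈-concat⁻′ (map (rowCells n) (rows n)) p
... | cs , c∈cs , cs∈ with ∈-map⁻ (rowCells n) cs∈
... | _ , i∈ , refl with ∈-map⁻ suc i∈
... | i , _ , refl with ∈row (suc i) (n ∸ suc i) c∈cs
... | j , j< , refl = s≤s z≤n , s≤s z≤n , <∸⇒+-suc-≤ (suc i) j n j<

InStaircase⇒∈cells : ∀ n {c} → InStaircase n c → c ∈ cells n
InStaircase⇒∈cells n {suc i , suc j} (_ , _ , p) =
  ∈-concat⁺′ {xss = map (rowCells n) (rows n)}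
    (∈-map⁺ (suc i ,_) (∈-map⁺ suc (∈-downFrom⁺ (+-suc-≤⇒<∸ (suc i) j n p))))
    (∈-map⁺ (rowCells n) (∈rows (<-≤-trans (m<m+n (suc i) (s≤s z≤n)) p)))

row-sorted : ∀ i k → Sorted (row i k)
row-sorted i zero    = []
row-sorted i (suc k) = All.tabulate first ∷ row-sorted i k
  where
  first : ∀ {c} → c ∈ row i k → (i , suc k) ≺ c
  first p with ∈row i k p
  ... | _ , j<k , refl = inj₂ (refl , s≤s j<k)

cells-sorted : ∀ n → Sorted (cells n)
cells-sorted n = concat-sorted (AllPairs.map⁺ (AllPairs.applyUpTo⁺₁ id (n ∸ 1) (λ i<j _ → s≤s i<j)))
  where
  concat-sorted : ∀ {is} → AllPairs _<_ is → Sorted (concatMap (rowCells n) is)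
  concat-sorted []                = []
  concat-sorted {i ∷ is} (i< ∷ r) =
    AllPairs.++⁺ (row-sorted i (n ∸ i)) (concat-sorted r)
      (All.tabulate λ x∈ → All.tabulate λ y∈ → earlierRow x∈ y∈)
    where
    earlierRow : ∀ {x y} → x ∈ rowCells n i → y ∈ concatMap (rowCells n) is → x ≺ y
    earlierRow x∈ y∈ with ∈row i (n ∸ i) x∈ | ∈-concat⁻′ (map (rowCells n) is) y∈
    ... | _ , _ , refl | ys , y∈ys , ys∈ with ∈-map⁻ (rowCells n) ys∈
    ... | k , k∈ , refl with ∈row k (n ∸ k) y∈ys
    ... | _ , _ , refl = inj₁ (All.lookup i< k∈)

select : (xs : List Cell) → Vec Bool (length xs) → List Cell
select xs v = map proj₁ (filterᵇ proj₂ (Vec.toList (Vec.zip (Vec.fromList xs) v)))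

select-⊆ : ∀ xs v {c} → c ∈ select xs v → c ∈ xs
select-⊆ []       Vec.[]           ()
select-⊆ (x ∷ xs) (true  Vec.∷ v) (here refl) = here refl
select-⊆ (x ∷ xs) (true  Vec.∷ v) (there p)   = there (select-⊆ xs v p)
select-⊆ (x ∷ xs) (false Vec.∷ v) p           = there (select-⊆ xs v p)

select-length : ∀ xs v → length (select xs v) ≤ length xs
select-length []       Vec.[]           = z≤n
select-length (x ∷ xs) (true  Vec.∷ v) = s≤s (select-length xs v)
select-length (x ∷ xs) (false Vec.∷ v) = m≤n⇒m≤1+n (select-length xs v)

select-sorted : ∀ xs v → Sorted xs → Sorted (select xs v)
select-sorted []       Vec.[]           _       = []
select-sorted (x ∷ xs) (true  Vec.∷ v) (p ∷ s) =
  All.tabulate (All.lookup p ∘ select-⊆ xs v) ∷ select-sorted xs v s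
select-sorted (x ∷ xs) (false Vec.∷ v) (p ∷ s) = select-sorted xs v s

select-map : ∀ xs (f : Cell → Bool) → select xs (Vec.map f (Vec.fromList xs)) ≡ filterᵇ f xs
select-map []       f = refl
select-map (x ∷ xs) f with f x
... | true  = cong (x ∷_) (select-map xs f)
... | false = select-map xs f

select-injective : ∀ xs v u → Sorted xs → select xs v ≡ select xs u → v ≡ u
select-injective []       Vec.[]           Vec.[]           _       _ = refl
select-injective (x ∷ xs) (true  Vec.∷ v) (true  Vec.∷ u) (p ∷ s) e =
  cong (true Vec.∷_) (select-injective xs v u s (∷-injectiveʳ e))
select-injective (x ∷ xs) (false Vec.∷ v) (false Vec.∷ u) (p ∷ s) e =
  cong (false Vec.∷_) (select-injective xs v u s e)
select-injective (x ∷ xs) (true  Vec.∷ v) (false Vec.∷ u) (p ∷ s) e =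
  ⊥-elim (≺-irrefl (All.lookup p (select-⊆ xs u (subst (x ∈_) e (here refl)))))
select-injective (x ∷ xs) (false Vec.∷ v) (true  Vec.∷ u) (p ∷ s) e =
  ⊥-elim (≺-irrefl (All.lookup p (select-⊆ xs v (subst (x ∈_) (sym e) (here refl)))))

crosses-sorted : ∀ {n} (P : PipeDream n) → Sorted (crosses P)
crosses-sorted {n} P = select-sorted (cells n) (marks P) (cells-sorted n)

crosses-InStaircase : ∀ {n} (P : PipeDream n) {c} → c ∈ crosses P → InStaircase n c
crosses-InStaircase {n} P = ∈cells⇒InStaircase n ∘ select-⊆ (cells n) (marks P)

crosses-length : ∀ {n} (P : PipeDream n) → length (crosses P) ≤ size n
crosses-length {n} P = select-length (cells n) (marks P)

crosses-injective : ∀ {n} (P R : PipeDream n) → crosses P ≡ crosses R → P ≡ R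
crosses-injective {n} (pd v) (pd u) e = cong pd (select-injective (cells n) v u (cells-sorted n) e)

¬T⇒≡false : ∀ {b} → ¬ T b → b ≡ false
¬T⇒≡false ¬t = ¬-not (¬t ∘ Equivalence.from T-≡)

==ᶜ-refl : ∀ c → T (c ==ᶜ c)
==ᶜ-refl (a , b) = Equivalence.from T-∧ (≡⇒≡ᵇ a a refl , ≡⇒≡ᵇ b b refl)

==ᶜ⇒≡ : ∀ c d → T (c ==ᶜ d) → c ≡ d
==ᶜ⇒≡ (a , b) (c , d) t with Equivalence.to T-∧ t
... | p , q = cong₂ _,_ (≡ᵇ⇒≡ a c p) (≡ᵇ⇒≡ b d q)

memᶜ⇒∈ : ∀ c D → T (memᶜ c D) → c ∈ D
memᶜ⇒∈ c (d ∷ D) t with Equivalence.to (T-∨ {c ==ᶜ d}) t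
... | inj₁ p = here (==ᶜ⇒≡ c d p)
... | inj₂ p = there (memᶜ⇒∈ c D p)

∈⇒memᶜ : ∀ c D → c ∈ D → T (memᶜ c D)
∈⇒memᶜ c (d ∷ D) (here refl) = Equivalence.from (T-∨ {c ==ᶜ c}) (inj₁ (==ᶜ-refl c))
∈⇒memᶜ c (d ∷ D) (there p)   = Equivalence.from (T-∨ {c ==ᶜ d}) (inj₂ (∈⇒memᶜ c D p))

sorted-≐⇒≡ : ∀ {xs ys} → Sorted xs → Sorted ys →
  (∀ {c} → c ∈ xs → c ∈ ys) → (∀ {c} → c ∈ ys → c ∈ xs) → xs ≡ ys
sorted-≐⇒≡ {[]}     {[]}     _ _ _ _ = refl
sorted-≐⇒≡ {[]}     {y ∷ ys} _ _ _ g with () ← g (here refl)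
sorted-≐⇒≡ {x ∷ xs} {[]}     _ _ f _ with () ← f (here refl)
sorted-≐⇒≡ {x ∷ xs} {y ∷ ys} (px ∷ sx) (py ∷ sy) f g with f (here refl) | g (here refl)
... | here refl | _         = cong (x ∷_) (sorted-≐⇒≡ sx sy (tail px f) (tail py g))
  where
  tail : ∀ {z zs ws} → All (z ≺_) zs → (∀ {c} → c ∈ z ∷ zs → c ∈ z ∷ ws) → ∀ {c} → c ∈ zs → c ∈ ws
  tail pz h c∈ with h (there c∈)
  ... | here refl = ⊥-elim (≺-irrefl (All.lookup pz c∈))
  ... | there q   = q
... | there p   | here refl = ⊥-elim (≺-irrefl (All.lookup py p))
... | there p   | there q   = ⊥-elim (≺-asym (All.lookup px q) (All.lookup py p))

crosses-fromCells : ∀ n E S → Sorted S → All (InStaircase n) S →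
  (∀ {c} → c ∈ S → c ∈ E) → (∀ {c} → InStaircase n c → c ∈ E → c ∈ S) →
  crosses (fromCells n E) ≡ S
crosses-fromCells n E S sS inS S⊆E E⊆S =
  trans (select-map (cells n) inE)
    (sorted-≐⇒≡ (AllPairs.filter⁺ (T? ∘ inE) (cells-sorted n)) sS from to)
  where
  inE : Cell → Bool
  inE c = memᶜ c E
  from : ∀ {c} → c ∈ filterᵇ inE (cells n) → c ∈ S
  from p with ∈-filter⁻ (T? ∘ inE) {xs = cells n} p
  ... | c∈ , t = E⊆S (∈cells⇒InStaircase n c∈) (memᶜ⇒∈ _ E t)
  to : ∀ {c} → c ∈ S → c ∈ filterᵇ inE (cells n)
  to p = ∈-filter⁺ (T? ∘ inE) (InStaircase⇒∈cells n (All.lookup inS p)) (∈⇒memᶜ _ E (S⊆E p))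

sorted-middleˡ : ∀ D₁ {c D₂ a} → Sorted (D₁ ++ c ∷ D₂) → a ∈ D₁ → a ≺ c
sorted-middleˡ (b ∷ D₁) (pb ∷ s) (here refl) = All.lookup pb (∈-++⁺ʳ D₁ (here refl))
sorted-middleˡ (b ∷ D₁) (pb ∷ s) (there q)   = sorted-middleˡ D₁ s q

sorted-middleʳ : ∀ D₁ {c D₂} → Sorted (D₁ ++ c ∷ D₂) → All (c ≺_) D₂
sorted-middleʳ []       (pc ∷ s) = pc
sorted-middleʳ (b ∷ D₁) (pb ∷ s) = sorted-middleʳ D₁ s

sorted-suffix : ∀ D₁ {D₂} → Sorted (D₁ ++ D₂) → Sorted D₂
sorted-suffix []       s       = s
sorted-suffix (a ∷ D₁) (_ ∷ s) = sorted-suffix D₁ s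

sorted-replace : ∀ D₁ {c x D₂} → Sorted (D₁ ++ c ∷ D₂) → (∀ {a} → a ≺ c → a ≺ x) →
  All (x ≺_) D₂ → Sorted (D₁ ++ x ∷ D₂)
sorted-replace []       (pc ∷ s) _ px = px ∷ s
sorted-replace (a ∷ D₁) {c} {x} {D₂} (pa ∷ s) h px = All.tabulate a≺ ∷ sorted-replace D₁ s h px
  where
  a≺ : ∀ {e} → e ∈ D₁ ++ x ∷ D₂ → a ≺ e
  a≺ e∈ with ∈-++⁻ D₁ e∈
  ... | inj₁ q           = All.lookup pa (∈-++⁺ˡ q)
  ... | inj₂ (here refl) = h (All.lookup pa (∈-++⁺ʳ D₁ (here refl)))
  ... | inj₂ (there q)   = All.lookup pa (∈-++⁺ʳ D₁ (there q))

sorted-delete : ∀ D₁ {c D₂} → Sorted (D₁ ++ c ∷ D₂) → Sorted (D₁ ++ D₂)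
sorted-delete []       (pc ∷ s) = s
sorted-delete (a ∷ D₁) {c} {D₂} (pa ∷ s) = All.tabulate a≺ ∷ sorted-delete D₁ s
  where
  a≺ : ∀ {e} → e ∈ D₁ ++ D₂ → a ≺ e
  a≺ e∈ with ∈-++⁻ D₁ e∈
  ... | inj₁ q = All.lookup pa (∈-++⁺ˡ q)
  ... | inj₂ q = All.lookup pa (∈-++⁺ʳ D₁ (there q))

minM-nothing : ∀ xs → minM xs ≡ nothing → xs ≡ []
minM-nothing []       _ = refl
minM-nothing (x ∷ xs) e with minM xs
minM-nothing (x ∷ xs) () | nothing
minM-nothing (x ∷ xs) () | just _

maxM-nothing : ∀ xs → maxM xs ≡ nothing → xs ≡ []
maxM-nothing []       _ = refl
maxM-nothing (x ∷ xs) e with maxM xs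
maxM-nothing (x ∷ xs) () | nothing
maxM-nothing (x ∷ xs) () | just _

minM-just : ∀ xs {m} → minM xs ≡ just m → m ∈ xs × All (m ≤_) xs
minM-just (x ∷ xs) e with minM xs in eq
minM-just (x ∷ xs) refl | nothing rewrite minM-nothing xs eq = here refl , ≤-refl ∷ []
minM-just (x ∷ xs) refl | just y with minM-just xs eq | ⊓-sel x y
... | y∈ , y≤ | inj₁ e rewrite e = here refl , ≤-refl ∷ All.map (≤-trans (subst (_≤ y) e (m⊓n≤n x y))) y≤
... | y∈ , y≤ | inj₂ e rewrite e = there y∈ , subst (_≤ x) e (m⊓n≤m x y) ∷ y≤

maxM-just : ∀ xs {m} → maxM xs ≡ just m → m ∈ xs × All (_≤ m) xs
maxM-just (x ∷ xs) e with maxM xs in eq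
maxM-just (x ∷ xs) refl | nothing rewrite maxM-nothing xs eq = here refl , ≤-refl ∷ []
maxM-just (x ∷ xs) refl | just y with maxM-just xs eq | ⊔-sel x y
... | y∈ , ≤y | inj₁ e rewrite e = here refl , ≤-refl ∷ All.map (λ q → ≤-trans q (subst (y ≤_) e (m≤n⊔m x y))) ≤y
... | y∈ , ≤y | inj₂ e rewrite e = there y∈ , subst (x ≤_) e (m≤m⊔n x y) ∷ ≤y

minM-least : ∀ xs j → j ∈ xs → All (j ≤_) xs → minM xs ≡ just j
minM-least xs j j∈ j≤ with minM xs in eq
... | nothing with () ← subst (j ∈_) (minM-nothing xs eq) j∈
... | just m with minM-just xs eq
... | m∈ , m≤ = cong just (≤-antisym (All.lookup m≤ j∈) (All.lookup j≤ m∈))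

rowCols⇒∈ : ∀ D i {j} → j ∈ rowCols D i → (i , j) ∈ D
rowCols⇒∈ D i p with ∈-map⁻ proj₂ p
... | (r , s) , c∈ , refl with ∈-filter⁻ (T? ∘ (λ c → proj₁ c ≡ᵇ i)) {xs = D} c∈
... | q , t rewrite ≡ᵇ⇒≡ r i t = q

∈⇒rowCols : ∀ D i {j} → (i , j) ∈ D → j ∈ rowCols D i
∈⇒rowCols D i p = ∈-map⁺ proj₂ (∈-filter⁺ (T? ∘ (λ c → proj₁ c ≡ᵇ i)) p (≡⇒≡ᵇ i i refl))

-- Slide moves

slidCells : ℕ → ℕ → List Cell → List Cell
slidCells i j D = (suc i , j ∸ 1) ∷ filterᵇ (λ c → not (c ==ᶜ (i , j))) D

slideAllowed : ℕ → ℕ → List Cell → Bool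
slideAllowed i j D = (2 ≤ᵇ j) ∧ rightOf (maxM (rowCols D (suc i))) j

slide-unfold : ∀ {n} i (P : PipeDream n) {j} → minM (rowCols (crosses P) i) ≡ just j →
  slide i P ≡ (if slideAllowed i j (crosses P) then fromCells n (slidCells i j (crosses P)) else P)
slide-unfold i P e rewrite e = refl

rightOf⇒< : ∀ xs j → T (rightOf (maxM xs) j) → All (_< j) xs
rightOf⇒< xs j t with maxM xs in eq
... | nothing rewrite maxM-nothing xs eq = []
... | just m with maxM-just xs eq
... | _ , ≤m = All.map (λ q → ≤-<-trans q (<ᵇ⇒< m j t)) ≤m

¬rightOf⇒≥ : ∀ xs j → rightOf (maxM xs) j ≡ false → ∃[ m ] (m ∈ xs × j ≤ m)
¬rightOf⇒≥ xs j e with maxM xs in eq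
... | just m with maxM-just xs eq
... | m∈ , _ = m , m∈ , ≮⇒≥ (λ m<j → subst T e (<⇒<ᵇ m<j))

slideAllowed⇒ : ∀ i j D → T (slideAllowed i j D) → 2 ≤ j × All (_< j) (rowCols D (suc i))
slideAllowed⇒ i j D t with Equivalence.to T-∧ t
... | a , b = ≤ᵇ⇒≤ 2 j a , rightOf⇒< (rowCols D (suc i)) j b

≢⇒==ᶜ-false : ∀ x c → x ≢ c → (x ==ᶜ c) ≡ false
≢⇒==ᶜ-false x c x≢c = ¬T⇒≡false (x≢c ∘ ==ᶜ⇒≡ x c)

¬T-not-==ᶜ-refl : ∀ c → ¬ T (not (c ==ᶜ c))
¬T-not-==ᶜ-refl c t with c ==ᶜ c | ==ᶜ-refl c
... | true | _ = t

crosses-slid : ∀ n D₁ D₂ D₂′ c x → Sorted (D₁ ++ c ∷ D₂) → Sorted (D₁ ++ x ∷ D₂′) →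
  (∀ {e} → e ∈ D₁ ++ c ∷ D₂ → InStaircase n e) → InStaircase n x →
  (∀ {e} → e ∈ D₂ → e ∈ x ∷ D₂′) → (∀ {e} → e ∈ D₂′ → e ∈ D₂) → x ≢ c →
  crosses (fromCells n (x ∷ filterᵇ (λ e → not (e ==ᶜ c)) (D₁ ++ c ∷ D₂))) ≡ D₁ ++ x ∷ D₂′
crosses-slid n D₁ D₂ D₂′ c x sD sS inD inx D₂⊆ D₂′⊆ x≢c =
  crosses-fromCells n E S sS (All.tabulate inS) S⊆E E⊆S
  where
  D = D₁ ++ c ∷ D₂
  E = x ∷ filterᵇ (λ e → not (e ==ᶜ c)) D
  S = D₁ ++ x ∷ D₂′
  kept : ∀ {e} → e ∈ D → e ≢ c → e ∈ filterᵇ (λ e → not (e ==ᶜ c)) D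
  kept {e} p ne = ∈-filter⁺ (T? ∘ (λ e → not (e ==ᶜ c))) p (subst (T ∘ not) (sym (≢⇒==ᶜ-false e c ne)) tt)
  inS : ∀ {e} → e ∈ S → InStaircase n e
  inS p with ∈-++⁻ D₁ p
  ... | inj₁ q           = inD (∈-++⁺ˡ q)
  ... | inj₂ (here refl) = inx
  ... | inj₂ (there q)   = inD (∈-++⁺ʳ D₁ (there (D₂′⊆ q)))
  S⊆E : ∀ {e} → e ∈ S → e ∈ E
  S⊆E p with ∈-++⁻ D₁ p
  ... | inj₁ q           = there (kept (∈-++⁺ˡ q) (≺⇒≢ (sorted-middleˡ D₁ sD q)))
  ... | inj₂ (here refl) = here refl
  ... | inj₂ (there q)   = there (kept (∈-++⁺ʳ D₁ (there (D₂′⊆ q)))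
                                   (≺⇒≢ (All.lookup (sorted-middleʳ D₁ sD) (D₂′⊆ q)) ∘ sym))
  E⊆S : ∀ {e} → InStaircase n e → e ∈ E → e ∈ S
  E⊆S _ (here refl) = ∈-++⁺ʳ D₁ (here refl)
  E⊆S {e} _ (there p) with ∈-filter⁻ (T? ∘ (λ e → not (e ==ᶜ c))) {xs = D} p
  ... | q , t with ∈-++⁻ D₁ q
  ... | inj₁ r           = ∈-++⁺ˡ r
  ... | inj₂ (here refl) = ⊥-elim (¬T-not-==ᶜ-refl e t)
  ... | inj₂ (there r)   = ∈-++⁺ʳ D₁ (D₂⊆ r)

data SlideStep (i j : ℕ) (D R : List Cell) : Set where
  move  : ∀ D₁ D₂ → D ≡ D₁ ++ (i , j) ∷ D₂ →
          R ≡ D₁ ++ (suc i , j ∸ 1) ∷ D₂ → SlideStep i j D R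
  merge : ∀ D₁ D₂ → D ≡ D₁ ++ (i , j) ∷ (suc i , j ∸ 1) ∷ D₂ →
          R ≡ D₁ ++ (suc i , j ∸ 1) ∷ D₂ → SlideStep i j D R

slid-≺-next : ∀ i k h D → h ∈ D → (i , suc k) ≺ h →
  (∀ {s} → (i , s) ∈ D → suc k ≤ s) → (∀ {s} → (suc i , s) ∈ D → s ≤ k) →
  h ≢ (suc i , k) → (suc i , k) ≺ h
slid-≺-next i k (r , s) D h∈ (inj₂ (refl , s<j)) rowᵢ _ _ =
  ⊥-elim (<-irrefl refl (<-≤-trans s<j (rowᵢ h∈)))
slid-≺-next i k (r , s) D h∈ (inj₁ i<r) _ rowᵢ₊₁ h≢ with m≤n⇒m<n∨m≡n i<r
... | inj₁ i+1<r = inj₁ i+1<r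
... | inj₂ refl  = inj₂ (refl , ≤∧≢⇒< (rowᵢ₊₁ h∈) (h≢ ∘ cong (suc i ,_)))

slideStep : ∀ n i k D → Sorted D → (∀ {c} → c ∈ D → InStaircase n c) → (i , suc (suc k)) ∈ D →
  (∀ {s} → (i , s) ∈ D → suc (suc k) ≤ s) → (∀ {s} → (suc i , s) ∈ D → s ≤ suc k) →
  SlideStep i (suc (suc k)) D (crosses (fromCells n (slidCells i (suc (suc k)) D)))
slideStep n i k D sD inD c∈ rowᵢ rowᵢ₊₁ with ∈-∃++ c∈
... | D₁ , D₂ , refl = step D₂ refl
  where
  c x : Cell
  c = (i , suc (suc k))
  x = (suc i , suc k)
  c≺x : ∀ {a} → a ≺ c → a ≺ x
  c≺x a≺c = ≺-trans a≺c (inj₁ ≤-refl)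
  x≢c : x ≢ c
  x≢c = ≺⇒≢ {c} {x} (inj₁ ≤-refl) ∘ sym
  inx : InStaircase n x
  inx with inD c∈
  ... | _ , _ , le = s≤s z≤n , s≤s z≤n , subst (_≤ n) (+-suc i (suc k)) le
  step : ∀ D₂′ → D₂′ ≡ D₂ → SlideStep i (suc (suc k)) (D₁ ++ c ∷ D₂)
           (crosses (fromCells n (slidCells i (suc (suc k)) (D₁ ++ c ∷ D₂))))
  step [] refl =
    move D₁ [] refl (crosses-slid n D₁ [] [] c x sD (sorted-replace D₁ sD c≺x []) inD inx there id x≢c)
  step (h ∷ D₃) refl with ×-≡-dec _≟_ _≟_ h x
  ... | yes refl = merge D₁ D₃ refl
        (crosses-slid n D₁ (x ∷ D₃) D₃ c x sD (sorted-delete D₁ sD) inD inx id there x≢c)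
  ... | no h≢x = move D₁ (h ∷ D₃) refl
        (crosses-slid n D₁ (h ∷ D₃) (h ∷ D₃) c x sD (sorted-replace D₁ sD c≺x x≺rest) inD inx there id x≢c)
    where
    x≺h : x ≺ h
    x≺h = slid-≺-next i (suc k) h _ (∈-++⁺ʳ D₁ (there (here refl)))
            (All.lookup (sorted-middleʳ D₁ sD) (here refl)) rowᵢ rowᵢ₊₁ h≢x
    x≺rest : All (x ≺_) (h ∷ D₃)
    x≺rest with sorted-suffix D₁ sD
    ... | _ ∷ (h≺ ∷ _) = x≺h ∷ All.map (≺-trans x≺h) h≺

slide-id⊎step : ∀ {n} i (P : PipeDream n) →
  slide i P ≡ P ⊎ ∃[ k ] SlideStep i (suc (suc k)) (crosses P) (crosses (slide i P))
slide-id⊎step {n} i P with minM (rowCols (crosses P) i) in eq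
... | nothing = inj₁ refl
... | just j with slideAllowed i j (crosses P) in allowed
... | false = inj₁ refl
... | true with slideAllowed⇒ i j (crosses P) (subst T (sym allowed) tt) | minM-just (rowCols (crosses P) i) eq
... | s≤s (s≤s {n = k} _) , rowᵢ₊₁< | j∈ , j≤ = inj₂ (k ,
        slideStep n i k D (crosses-sorted P) (crosses-InStaircase P) (rowCols⇒∈ D i j∈)
          (All.lookup j≤ ∘ ∈⇒rowCols D i)
          (s≤s⁻¹ ∘ All.lookup rowᵢ₊₁< ∘ ∈⇒rowCols D (suc i)))
  where D = crosses P

prepend : ℕ → List ℕ → List ℕ
prepend x []       = x ∷ []
prepend x (y ∷ ys) = if x ≡ᵇ y then y ∷ ys else x ∷ y ∷ ys

collapse-∷ : ∀ x xs → collapse (x ∷ xs) ≡ prepend x (collapse xs)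
collapse-∷ x xs with collapse xs
... | []     = refl
... | y ∷ ys = refl

≡ᵇ-refl : ∀ a → (a ≡ᵇ a) ≡ true
≡ᵇ-refl a = Equivalence.to T-≡ (≡⇒≡ᵇ a a refl)

≢⇒≡ᵇ-false : ∀ {a b} → a ≢ b → (a ≡ᵇ b) ≡ false
≢⇒≡ᵇ-false {a} {b} a≢b = ¬T⇒≡false (a≢b ∘ ≡ᵇ⇒≡ a b)

prepend-idem : ∀ a r → prepend a (prepend a r) ≡ prepend a r
prepend-idem a [] rewrite ≡ᵇ-refl a = refl
prepend-idem a (y ∷ ys) with a ≡ᵇ y in eq
... | true  rewrite eq = refl
... | false rewrite ≡ᵇ-refl a = refl

collapse-dup : ∀ a L → collapse (a ∷ a ∷ L) ≡ collapse (a ∷ L)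
collapse-dup a L = begin
  collapse (a ∷ a ∷ L)                ≡⟨ collapse-∷ a (a ∷ L) ⟩
  prepend a (collapse (a ∷ L))        ≡⟨ cong (prepend a) (collapse-∷ a L) ⟩
  prepend a (prepend a (collapse L))  ≡⟨ prepend-idem a (collapse L) ⟩
  prepend a (collapse L)              ≡⟨ collapse-∷ a L ⟨
  collapse (a ∷ L)                    ∎
  where open ≡-Reasoning

collapse-++ : ∀ L₁ {L L′} → collapse L ≡ collapse L′ → collapse (L₁ ++ L) ≡ collapse (L₁ ++ L′)
collapse-++ []       e = e
collapse-++ (x ∷ L₁) {L} {L′} e = begin
  collapse (x ∷ L₁ ++ L)         ≡⟨ collapse-∷ x (L₁ ++ L) ⟩
  prepend x (collapse (L₁ ++ L))  ≡⟨ cong (prepend x) (collapse-++ L₁ e) ⟩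
  prepend x (collapse (L₁ ++ L′)) ≡⟨ collapse-∷ x (L₁ ++ L′) ⟨
  collapse (x ∷ L₁ ++ L′)        ∎
  where open ≡-Reasoning

columnSum : List Cell → ℕ
columnSum []            = 0
columnSum ((_ , j) ∷ D) = j + columnSum D

columnSum-++ : ∀ A B → columnSum (A ++ B) ≡ columnSum A + columnSum B
columnSum-++ []            B = refl
columnSum-++ ((_ , j) ∷ A) B = trans (cong (j +_) (columnSum-++ A B)) (sym (+-assoc j _ _))

columnSum-≤ : ∀ n D → (∀ {c} → c ∈ D → InStaircase n c) → columnSum D ≤ length D * n
columnSum-≤ n []            _  = z≤n
columnSum-≤ n ((i , j) ∷ D) inD with inD (here refl)
... | _ , _ , le = +-mono-≤ (≤-trans (m≤n+m j i) le) (columnSum-≤ n D (inD ∘ there))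

letter-slid : ∀ i k → letter (suc i , suc k) ≡ letter (i , suc (suc k))
letter-slid i k = sym (cong (_∸ 1) (+-suc i (suc k)))

slideStep-collapse : ∀ {i k D R} → SlideStep i (suc (suc k)) D R →
  collapse (map letter R) ≡ collapse (map letter D)
slideStep-collapse {i} {k} (move D₁ D₂ refl refl) =
  cong collapse (begin
    map letter (D₁ ++ x ∷ D₂)                    ≡⟨ map-++ letter D₁ _ ⟩
    map letter D₁ ++ letter x ∷ map letter D₂    ≡⟨ cong (λ a → map letter D₁ ++ a ∷ map letter D₂) (letter-slid i k) ⟩
    map letter D₁ ++ letter c ∷ map letter D₂    ≡⟨ map-++ letter D₁ _ ⟨
    map letter (D₁ ++ c ∷ D₂)                    ∎)
  where
  open ≡-Reasoning
  x = (suc i , suc k)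
  c = (i , suc (suc k))
slideStep-collapse {i} {k} (merge D₁ D₂ refl refl) = begin
  collapse (map letter (D₁ ++ x ∷ D₂))                         ≡⟨ cong collapse (map-++ letter D₁ _) ⟩
  collapse (map letter D₁ ++ letter x ∷ map letter D₂)         ≡⟨ collapse-++ (map letter D₁) dup ⟩
  collapse (map letter D₁ ++ letter c ∷ letter x ∷ map letter D₂) ≡⟨ cong collapse (map-++ letter D₁ _) ⟨
  collapse (map letter (D₁ ++ c ∷ x ∷ D₂))                     ∎
  where
  open ≡-Reasoning
  x = (suc i , suc k)
  c = (i , suc (suc k))
  dup : collapse (letter x ∷ map letter D₂) ≡ collapse (letter c ∷ letter x ∷ map letter D₂)
  dup rewrite letter-slid i k = sym (collapse-dup (letter c) (map letter D₂))

slideStep-columnSum : ∀ {i k D R} → SlideStep i (suc (suc k)) D R → columnSum R < columnSum D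
slideStep-columnSum {i} {k} (move D₁ D₂ refl refl)
  rewrite columnSum-++ D₁ ((suc i , suc k) ∷ D₂) | columnSum-++ D₁ ((i , suc (suc k)) ∷ D₂) =
  +-monoʳ-< (columnSum D₁) (+-monoˡ-< (columnSum D₂) ≤-refl)
slideStep-columnSum {i} {k} (merge D₁ D₂ refl refl)
  rewrite columnSum-++ D₁ ((suc i , suc k) ∷ D₂) | columnSum-++ D₁ ((i , suc (suc k)) ∷ (suc i , suc k) ∷ D₂) =
  +-monoʳ-< (columnSum D₁) (m<n+m (suc k + columnSum D₂) {suc (suc k)} (s≤s z≤n))

slide-collapse : ∀ {n} i (P : PipeDream n) → collapse (word (slide i P)) ≡ collapse (word P)
slide-collapse i P with slide-id⊎step i P
... | inj₁ e       = cong (collapse ∘ word) e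
... | inj₂ (_ , s) = slideStep-collapse s

slide-columnSum : ∀ {n} i (P : PipeDream n) →
  slide i P ≡ P ⊎ columnSum (crosses (slide i P)) < columnSum (crosses P)
slide-columnSum i P with slide-id⊎step i P
... | inj₁ e       = inj₁ e
... | inj₂ (_ , s) = inj₂ (slideStep-columnSum s)

-- The destandardization map

≡ᵖ?⇒≡ : ∀ {n} (P R : PipeDream n) → T (≡ᵖ? P R) → P ≡ R
≡ᵖ?⇒≡ P R t with Vec.≡-dec Bool._≟_ (marks P) (marks R)
... | yes e = cong pd e

≡ᵖ?-refl : ∀ {n} (P : PipeDream n) → T (≡ᵖ? P P)
≡ᵖ?-refl P with Vec.≡-dec Bool._≟_ (marks P) (marks P)
... | yes _ = tt
... | no ne = ne refl

firstSlide-nothing : ∀ {n} is (P : PipeDream n) → firstSlide is P ≡ nothing → All (λ i → slide i P ≡ P) is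
firstSlide-nothing []       P e = []
firstSlide-nothing (i ∷ is) P e with ≡ᵖ? (slide i P) P in eq
... | true = ≡ᵖ?⇒≡ _ _ (subst T (sym eq) tt) ∷ firstSlide-nothing is P e

firstSlide-just : ∀ {n} is (P R : PipeDream n) → firstSlide is P ≡ just R →
  ∃[ i ] (R ≡ slide i P × slide i P ≢ P)
firstSlide-just (i ∷ is) P R e with ≡ᵖ? (slide i P) P in eq
... | true = firstSlide-just is P R e
firstSlide-just (i ∷ is) P R refl | false =
  i , refl , λ slid≡P → subst T eq (subst (λ Z → T (≡ᵖ? Z P)) (sym slid≡P) (≡ᵖ?-refl P))

dstFuel-collapse : ∀ {n} k (P : PipeDream n) → collapse (word (dstFuel k P)) ≡ collapse (word P)
dstFuel-collapse zero P = refl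
dstFuel-collapse {n} (suc k) P with firstSlide (rows n) P in eq
... | nothing = refl
... | just R with firstSlide-just (rows n) P R eq
... | i , refl , _ = trans (dstFuel-collapse k (slide i P)) (slide-collapse i P)

dstFuel-QY : ∀ {n} k (P : PipeDream n) → columnSum (crosses P) < k → QuasiYamanouchi (dstFuel k P)
dstFuel-QY {n} (suc k) P lt with firstSlide (rows n) P in eq
... | nothing = λ { (suc i) _ i<n → All.lookup (firstSlide-nothing (rows n) P eq) (∈rows i<n) }
... | just R with firstSlide-just (rows n) P R eq
... | i , refl , moved with slide-columnSum i P
... | inj₁ fixed = ⊥-elim (moved fixed)
... | inj₂ lower = dstFuel-QY k (slide i P) (<-≤-trans lower (s≤s⁻¹ lt))

dst-QY : ∀ {n} (P : PipeDream n) → QuasiYamanouchi (dst P)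
dst-QY {n} P = dstFuel-QY (suc (size n * n)) P
  (s≤s (≤-trans (columnSum-≤ n (crosses P) (crosses-InStaircase P)) (*-monoˡ-≤ n (crosses-length P))))

dst-collapse : ∀ {n} (P : PipeDream n) → collapse (word (dst P)) ≡ collapse (word P)
dst-collapse {n} P = dstFuel-collapse (suc (size n * n)) P

-- Quasi-Yamanouchi pipe dreams

-- What keeps S_i from moving the cross (i , j), in terms of the cross read after it.
SlideBlocked : Cell → List Cell → Set
SlideBlocked (i , j) []            = j ≡ 1
SlideBlocked (i , j) ((r , s) ∷ _) = i ≡ r ⊎ j ≡ 1 ⊎ (r ≡ suc i × j ≤ s)

AllSlideBlocked : List Cell → Set
AllSlideBlocked []      = ⊤
AllSlideBlocked (c ∷ B) = SlideBlocked c B × AllSlideBlocked B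

≺⇒row≤ : ∀ {a b c d} → (a , b) ≺ (c , d) → a ≤ c
≺⇒row≤ (inj₁ p)          = <⇒≤ p
≺⇒row≤ (inj₂ (refl , _)) = ≤-refl

∈-after : ∀ A {c B e} → Sorted (A ++ c ∷ B) → e ∈ A ++ c ∷ B → c ≺ e → e ∈ B
∈-after A s e∈ c≺e with ∈-++⁻ A e∈
... | inj₁ q           = ⊥-elim (≺-asym c≺e (sorted-middleˡ A s q))
... | inj₂ (here refl) = ⊥-elim (≺-irrefl c≺e)
... | inj₂ (there q)   = q

last-in-row-leftmost : ∀ A {i j B} → Sorted (A ++ (i , j) ∷ B) → (∀ {s} → (i , s) ∉ B) →
  ∀ {s} → (i , s) ∈ A ++ (i , j) ∷ B → j ≤ s
last-in-row-leftmost A sD notInB p with ∈-++⁻ A p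
... | inj₂ (here refl) = ≤-refl
... | inj₂ (there q)   = ⊥-elim (notInB q)
... | inj₁ q with sorted-middleˡ A sD q
...   | inj₁ i<i       = ⊥-elim (<-irrefl refl i<i)
...   | inj₂ (_ , j<s) = <⇒≤ j<s

leftmost-blocked : ∀ {n} (P : PipeDream n) → QuasiYamanouchi P → ∀ {i k} →
  (i , suc (suc k)) ∈ crosses P → (∀ {s} → (i , s) ∈ crosses P → suc (suc k) ≤ s) →
  ∃[ m ] ((suc i , m) ∈ crosses P × suc (suc k) ≤ m)
leftmost-blocked {n} P qy {i} {k} c∈ leftmost
  with crosses-InStaircase P c∈
     | rightOf (maxM (rowCols (crosses P) (suc i))) (suc (suc k)) in allowed
     | slide-unfold i P (minM-least (rowCols (crosses P) i) _ (∈⇒rowCols (crosses P) i c∈)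
                                    (All.tabulate (leftmost ∘ rowCols⇒∈ (crosses P) i)))
-- Otherwise S_i moves (i , j), lowering the column sum of P = S_i P.
... | 1≤i , _ , i+j≤n | true | unfolded =
  ⊥-elim (<-irrefl (cong (columnSum ∘ crosses) fixed) (slideStep-columnSum fires))
  where
  D = crosses P
  fixed : fromCells n (slidCells i (suc (suc k)) D) ≡ P
  fixed = trans (sym unfolded) (qy i 1≤i (<-≤-trans (m<m+n i (s≤s z≤n)) i+j≤n))
  fires : SlideStep i (suc (suc k)) D (crosses (fromCells n (slidCells i (suc (suc k)) D)))
  fires = slideStep n i k D (crosses-sorted P) (crosses-InStaircase P) c∈ leftmost
            (s≤s⁻¹ ∘ All.lookup (rightOf⇒< (rowCols D (suc i)) _ (subst T (sym allowed) tt)) ∘ ∈⇒rowCols D (suc i))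
... | _ | false | _ with ¬rightOf⇒≥ (rowCols (crosses P) (suc i)) _ allowed
...   | m , m∈ , j≤m = m , rowCols⇒∈ (crosses P) (suc i) m∈ , j≤m

last-in-row-blocked : ∀ {n} (P : PipeDream n) → QuasiYamanouchi P → ∀ A {i k} B →
  crosses P ≡ A ++ (i , suc (suc k)) ∷ B → (∀ {s} → (i , s) ∉ B) →
  ∃[ m ] ((suc i , m) ∈ B × suc (suc k) ≤ m)
last-in-row-blocked P qy A B e notInB
  with leftmost-blocked P qy (subst (_ ∈_) (sym e) (∈-++⁺ʳ A (here refl)))
         (last-in-row-leftmost A (subst Sorted e (crosses-sorted P)) notInB ∘ subst (_ ∈_) e)
... | m , m∈ , j≤m = m , ∈-after A (subst Sorted e (crosses-sorted P)) (subst (_ ∈_) e m∈) (inj₁ ≤-refl) , j≤m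

earlier-row-absent : ∀ {i r s s′ B} → All ((r , s) ≺_) B → i < r → (i , s′) ∉ (r , s) ∷ B
earlier-row-absent _  i<r (here refl) = <-irrefl refl i<r
earlier-row-absent rs i<r (there q)   = <⇒≱ i<r (≺⇒row≤ (All.lookup rs q))

next-row-after : ∀ {i j r s m B} → All ((r , s) ≺_) B → i < r → (suc i , m) ∈ B → j ≤ m →
  r ≡ suc i × j ≤ s
next-row-after rs i<r q j≤m with All.lookup rs q
... | inj₁ r<i+1        = ⊥-elim (<-irrefl refl (<-≤-trans i<r (s≤s⁻¹ r<i+1)))
... | inj₂ (r≡i+1 , m<s) = r≡i+1 , ≤-trans j≤m (<⇒≤ m<s)

QY-slideBlocked : ∀ {n} (P : PipeDream n) → QuasiYamanouchi P →
  ∀ A c B → crosses P ≡ A ++ c ∷ B → SlideBlocked c B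
QY-slideBlocked P qy A (i , zero) B e
  with () ← proj₁ (proj₂ (crosses-InStaircase P (subst (_ ∈_) (sym e) (∈-++⁺ʳ A (here refl)))))
QY-slideBlocked P qy A (i , suc zero) []      e = refl
QY-slideBlocked P qy A (i , suc zero) (_ ∷ _) e = inj₂ (inj₁ refl)
QY-slideBlocked P qy A (i , suc (suc k)) [] e with last-in-row-blocked P qy A [] e (λ ())
... | _ , () , _
QY-slideBlocked P qy A (i , suc (suc k)) ((r , s) ∷ B) e
  with i ≟ r | sorted-suffix A (subst Sorted e (crosses-sorted P))
... | yes i≡r | _ = inj₁ i≡r
... | no i≢r | (inj₁ i<r ∷ _) ∷ rs ∷ _ with last-in-row-blocked P qy A ((r , s) ∷ B) e (earlier-row-absent rs i<r)
...   | m , here refl , j≤m = inj₂ (inj₂ (refl , j≤m))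
...   | m , there q , j≤m   = inj₂ (inj₂ (next-row-after rs i<r q j≤m))
QY-slideBlocked P qy A (i , suc (suc k)) ((r , s) ∷ B) e
  | no i≢r | (inj₂ (i≡r , _) ∷ _) ∷ _ = ⊥-elim (i≢r i≡r)

QY-allSlideBlocked : ∀ {n} (P : PipeDream n) → QuasiYamanouchi P → AllSlideBlocked (crosses P)
QY-allSlideBlocked P qy = go (crosses P) (QY-slideBlocked P qy)
  where
  go : ∀ D → (∀ A c B → D ≡ A ++ c ∷ B → SlideBlocked c B) → AllSlideBlocked D
  go []      _ = tt
  go (c ∷ B) h = h [] c B refl , go B (λ A c′ B′ e → h (c ∷ A) c′ B′ (cong (c ∷_) e))

data BlockedBy (i j r s : ℕ) : Set where
  sameRow     : i ≡ r → s < j → BlockedBy i j r s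
  firstColumn : i < r → j ≡ 1 → BlockedBy i j r s
  nextRow     : r ≡ suc i → j ≤ s → BlockedBy i j r s

blockedBy : ∀ {i j r s B} → (i , j) ≺ (r , s) → SlideBlocked (i , j) ((r , s) ∷ B) → BlockedBy i j r s
blockedBy (inj₂ (i≡r , s<j)) _                         = sameRow i≡r s<j
blockedBy (inj₁ i<r)         (inj₁ i≡r)                = ⊥-elim (<-irrefl i≡r i<r)
blockedBy (inj₁ i<r)         (inj₂ (inj₁ j≡1))         = firstColumn i<r j≡1
blockedBy (inj₁ i<r)         (inj₂ (inj₂ (r≡i+1 , j≤s))) = nextRow r≡i+1 j≤s

blockedBy-row-unique : ∀ {i j k l r s} → i + j ≡ k + l → 1 ≤ j → 1 ≤ l →
  BlockedBy i j r s → BlockedBy k l r s → i ≡ k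
blockedBy-row-unique e _ _ (sameRow p _) (sameRow q _) = trans p (sym q)
blockedBy-row-unique {i} {j} {k} e 1≤j _ (sameRow refl _) (firstColumn k<r refl) =
  ⊥-elim (<-irrefl refl (<-≤-trans (m<m+n i 1≤j) (subst (_≤ i) (sym (trans e (+-comm k 1))) k<r)))
blockedBy-row-unique {i} {_} {k} e _ 1≤l (firstColumn i<r refl) (sameRow refl _) =
  ⊥-elim (<-irrefl refl (<-≤-trans (m<m+n k 1≤l) (subst (_≤ k) (trans (+-comm 1 i) e) i<r)))
blockedBy-row-unique {_} {j} {k} {l} e _ _ (sameRow refl s<j) (nextRow refl l≤s)
  with refl ← +-cancelˡ-≡ k (suc j) l (trans (+-suc k j) e) =
  ⊥-elim (<-irrefl refl (<-trans (≤-<-trans l≤s s<j) (n<1+n j)))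
blockedBy-row-unique {i} {j} {_} {l} e _ _ (nextRow refl j≤s) (sameRow refl s<l)
  with refl ← +-cancelˡ-≡ i (suc l) j (trans (+-suc i l) (sym e)) =
  ⊥-elim (<-irrefl refl (<-trans (≤-<-trans j≤s s<l) (n<1+n l)))
blockedBy-row-unique {i} {_} {k} e _ _ (firstColumn _ refl) (firstColumn _ refl) = +-cancelʳ-≡ 1 i k e
blockedBy-row-unique {i} {_} {k} e _ 1≤l (firstColumn i<r refl) (nextRow refl _) =
  ≤-antisym (s≤s⁻¹ i<r) (+-cancelʳ-≤ 1 k i (≤-trans (+-monoʳ-≤ k 1≤l) (≤-reflexive (sym e))))
blockedBy-row-unique {i} {j} {k} e 1≤j _ (nextRow refl _) (firstColumn k<r refl) =
  sym (blockedBy-row-unique (sym e) (s≤s z≤n) 1≤j (firstColumn k<r refl) (nextRow refl ≤-refl))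
blockedBy-row-unique e _ _ (nextRow p _) (nextRow q _) = suc-injective (trans (sym p) q)

letter≡⇒diagonal≡ : ∀ {i j k l} → 1 ≤ i → 1 ≤ k → letter (i , j) ≡ letter (k , l) → i + j ≡ k + l
letter≡⇒diagonal≡ {suc i} {j} {suc k} {l} _ _ = cong suc

blocked-cell-unique : ∀ {i j k l} B → i + j ≡ k + l → 1 ≤ j → 1 ≤ l →
  All ((i , j) ≺_) B → All ((k , l) ≺_) B → SlideBlocked (i , j) B → SlideBlocked (k , l) B →
  (i , j) ≡ (k , l)
blocked-cell-unique {i} {j} {k} [] e _ _ _ _ refl refl with refl ← +-cancelʳ-≡ 1 i k e = refl
blocked-cell-unique {i} {j} {k} {l} ((r , s) ∷ B) e 1≤j 1≤l (p ∷ _) (q ∷ _) bᵢ bₖ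
  with refl ← blockedBy-row-unique e 1≤j 1≤l (blockedBy {B = B} p bᵢ) (blockedBy {B = B} q bₖ)
  with refl ← +-cancelˡ-≡ i j l e = refl

allSlideBlocked-word-injective : ∀ {n} D E → Sorted D → Sorted E →
  (∀ {c} → c ∈ D → InStaircase n c) → (∀ {c} → c ∈ E → InStaircase n c) →
  AllSlideBlocked D → AllSlideBlocked E → map letter D ≡ map letter E → D ≡ E
allSlideBlocked-word-injective [] [] _ _ _ _ _ _ _ = refl
allSlideBlocked-word-injective {n} ((i , j) ∷ D) ((k , l) ∷ E) (pD ∷ sD) (pE ∷ sE) inD inE (bD , lD) (bE , lE) e
  with refl ← allSlideBlocked-word-injective {n} D E sD sE (inD ∘ there) (inE ∘ there) lD lE (∷-injectiveʳ e)
  with 1≤i , 1≤j , _ ← inD (here refl) | 1≤k , 1≤l , _ ← inE (here refl) =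
  cong (_∷ D) (blocked-cell-unique D (letter≡⇒diagonal≡ 1≤i 1≤k (∷-injectiveˡ e)) 1≤j 1≤l pD pE bD bE)

blockedBy⇒diagonal≢ : ∀ {i j r s} → 1 ≤ s → BlockedBy i j r s → i + j ≢ r + s
blockedBy⇒diagonal≢ {i}         _   (sameRow refl s<j)    e = <-irrefl (sym e) (+-monoʳ-< i s<j)
blockedBy⇒diagonal≢ {i} {r = r} 1≤s (firstColumn i<r refl) e =
  <-irrefl e (≤-<-trans (subst (_≤ r) (+-comm 1 i) i<r) (m<m+n r 1≤s))
blockedBy⇒diagonal≢ {i} {s = s} _ (nextRow refl j≤s) e = <-irrefl e (≤-<-trans (+-monoʳ-≤ i j≤s) (n<1+n (i + s)))

collapse-allSlideBlocked : ∀ {n} D → Sorted D → (∀ {c} → c ∈ D → InStaircase n c) → AllSlideBlocked D →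
  collapse (map letter D) ≡ map letter D
collapse-allSlideBlocked []      _ _ _ = refl
collapse-allSlideBlocked (_ ∷ []) _ _ _ = refl
collapse-allSlideBlocked {n} ((i , j) ∷ (r , s) ∷ D) (p ∷ sD) inD (b , bD) = begin
  collapse (letter (i , j) ∷ map letter ((r , s) ∷ D))        ≡⟨ collapse-∷ (letter (i , j)) (map letter ((r , s) ∷ D)) ⟩
  prepend (letter (i , j)) (collapse (map letter ((r , s) ∷ D))) ≡⟨ cong (prepend _) (collapse-allSlideBlocked {n} _ sD (inD ∘ there) bD) ⟩
  prepend (letter (i , j)) (map letter ((r , s) ∷ D))         ≡⟨ prepend-distinct ⟩
  map letter ((i , j) ∷ (r , s) ∷ D)                          ∎
  where
  open ≡-Reasoning
  distinct : letter (i , j) ≢ letter (r , s)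
  distinct e with 1≤i , _ ← inD (here refl) | 1≤r , 1≤s , _ ← inD (there (here refl)) =
    blockedBy⇒diagonal≢ 1≤s (blockedBy {B = D} (All.lookup p (here refl)) b) (letter≡⇒diagonal≡ 1≤i 1≤r e)
  prepend-distinct : prepend (letter (i , j)) (map letter ((r , s) ∷ D)) ≡ map letter ((i , j) ∷ (r , s) ∷ D)
  prepend-distinct rewrite ≢⇒≡ᵇ-false distinct = refl

-- Reduct, shape and excess

reducedLetters : List ℕ → List ℕ → List ℕ
reducedLetters w []       = []
reducedLetters w (a ∷ as) = if ascent w a then a ∷ reducedLetters (rmul w a) as else reducedLetters w as

map-letter-keptCells : ∀ w cs → map letter (keptCells w cs) ≡ reducedLetters w (map letter cs)
map-letter-keptCells w []       = refl
map-letter-keptCells w (c ∷ cs) with ascent w (letter c)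
... | true  = cong (letter c ∷_) (map-letter-keptCells (rmul w (letter c)) cs)
... | false = map-letter-keptCells w cs

swapAt-swaps : ∀ k w → T (at w k <ᵇ at w (suc k)) →
  at (swapAt k w) k ≡ at w (suc k) × at (swapAt k w) (suc k) ≡ at w k
swapAt-swaps zero    (x ∷ y ∷ w) t = refl , refl
swapAt-swaps zero    (x ∷ [])    t with x <ᵇ 0
swapAt-swaps zero    (x ∷ [])    () | false
swapAt-swaps (suc k) (x ∷ w)     t = swapAt-swaps k w t

ascent⇒¬ascent-rmul : ∀ w a → ascent w a ≡ true → ascent (rmul w a) a ≡ false
ascent⇒¬ascent-rmul w zero e = ⊥-elim (<-irrefl refl (<ᵇ⇒< (at w 0) (at w 0) (subst T (sym e) tt)))
ascent⇒¬ascent-rmul w (suc k) e with swapAt-swaps k w (subst T (sym e) tt)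
... | p , q rewrite p | q = ¬T⇒≡false (<⇒≯ (<ᵇ⇒< (at w k) (at w (suc k)) (subst T (sym e) tt)) ∘ <ᵇ⇒< _ _)

reducedLetters-dup : ∀ w a L → reducedLetters w (a ∷ a ∷ L) ≡ reducedLetters w (a ∷ L)
reducedLetters-dup w a L with ascent w a in eq
... | true rewrite ascent⇒¬ascent-rmul w a eq = refl
... | false = refl

reducedLetters-prepend : ∀ w x r → reducedLetters w (prepend x r) ≡ reducedLetters w (x ∷ r)
reducedLetters-prepend w x [] = refl
reducedLetters-prepend w x (y ∷ ys) with x ≡ᵇ y in eq
... | true rewrite ≡ᵇ⇒≡ x y (subst T (sym eq) tt) = sym (reducedLetters-dup w y ys)
... | false = refl

reducedLetters-collapse : ∀ w L → reducedLetters w (collapse L) ≡ reducedLetters w L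
reducedLetters-collapse w []       = refl
reducedLetters-collapse w (x ∷ xs) = begin
  reducedLetters w (collapse (x ∷ xs))        ≡⟨ cong (reducedLetters w) (collapse-∷ x xs) ⟩
  reducedLetters w (prepend x (collapse xs))  ≡⟨ reducedLetters-prepend w x (collapse xs) ⟩
  reducedLetters w (x ∷ collapse xs)          ≡⟨ tail ⟩
  reducedLetters w (x ∷ xs)                   ∎
  where
  open ≡-Reasoning
  tail : reducedLetters w (x ∷ collapse xs) ≡ reducedLetters w (x ∷ xs)
  tail with ascent w x
  ... | true  = cong (x ∷_) (reducedLetters-collapse (rmul w x) xs)
  ... | false = reducedLetters-collapse w xs

keptCells-⊆ : ∀ w cs {x} → x ∈ keptCells w cs → x ∈ cs
keptCells-⊆ w (c ∷ cs) p with ascent w (letter c)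
keptCells-⊆ w (c ∷ cs) (here e)  | true  = here e
keptCells-⊆ w (c ∷ cs) (there p) | true  = there (keptCells-⊆ _ cs p)
keptCells-⊆ w (c ∷ cs) p         | false = there (keptCells-⊆ w cs p)

keptCells-sorted : ∀ w cs → Sorted cs → Sorted (keptCells w cs)
keptCells-sorted w []       _       = []
keptCells-sorted w (c ∷ cs) (p ∷ s) with ascent w (letter c)
... | true  = All.tabulate (All.lookup p ∘ keptCells-⊆ _ cs) ∷ keptCells-sorted _ cs s
... | false = keptCells-sorted w cs s

crosses-reduct : ∀ {n} (P : PipeDream n) → crosses (reduct P) ≡ keptCells (idPerm n) (crosses P)
crosses-reduct {n} P = crosses-fromCells n K K (keptCells-sorted _ _ (crosses-sorted P))
  (All.tabulate (crosses-InStaircase P ∘ keptCells-⊆ _ _)) id (λ _ → id)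
  where K = keptCells (idPerm n) (crosses P)

reducedWord : ∀ {n} → PipeDream n → List ℕ
reducedWord {n} P = reducedLetters (idPerm n) (collapse (word P))

word-reduct : ∀ {n} (P : PipeDream n) → word (reduct P) ≡ reducedWord P
word-reduct {n} P = begin
  map letter (crosses (reduct P))                   ≡⟨ cong (map letter) (crosses-reduct P) ⟩
  map letter (keptCells (idPerm n) (crosses P))     ≡⟨ map-letter-keptCells (idPerm n) (crosses P) ⟩
  reducedLetters (idPerm n) (word P)                ≡⟨ reducedLetters-collapse (idPerm n) (word P) ⟨
  reducedWord P                                     ∎
  where open ≡-Reasoning

filterᵇ-cong-∈ : ∀ (f g : Cell → Bool) D → (∀ {x} → x ∈ D → f x ≡ g x) → filterᵇ f D ≡ filterᵇ g D
filterᵇ-cong-∈ f g []      _ = refl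
filterᵇ-cong-∈ f g (x ∷ D) h with f x | g x | h (here refl)
... | true  | true  | _ = cong (x ∷_) (filterᵇ-cong-∈ f g D (h ∘ there))
... | false | false | _ = filterᵇ-cong-∈ f g D (h ∘ there)

length-dropped+kept : ∀ w D → Sorted D →
  length (filterᵇ (λ c → not (memᶜ c (keptCells w D))) D) + length (keptCells w D) ≡ length D
length-dropped+kept w []      _       = refl
length-dropped+kept w (c ∷ D) (p ∷ s) with ascent w (letter c)
... | true rewrite Equivalence.to T-≡ (==ᶜ-refl c) =
  trans (cong (_+ suc (length K)) dropped≡) (trans (+-suc _ (length K)) (cong suc (length-dropped+kept _ D s)))
  where
  K = keptCells (rmul w (letter c)) D
  dropped≡ : length (filterᵇ (λ x → not (memᶜ x (c ∷ K))) D) ≡ length (filterᵇ (λ x → not (memᶜ x K)) D)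
  dropped≡ = cong length (filterᵇ-cong-∈ _ _ D (λ {x} q →
               cong (λ b → not (b ∨ memᶜ x K)) (≢⇒==ᶜ-false x c (≺⇒≢ (All.lookup p q) ∘ sym))))
... | false rewrite ¬T⇒≡false (≺-irrefl ∘ All.lookup p ∘ keptCells-⊆ w D ∘ memᶜ⇒∈ c (keptCells w D)) =
  cong suc (length-dropped+kept w D s)

ex≡ : ∀ {n} (P : PipeDream n) → ex P ≡ length (crosses P) ∸ length (reducedWord P)
ex≡ {n} P = begin
  ex P                                       ≡⟨ cong (λ K → length (dropped K)) (crosses-reduct P) ⟩
  length (dropped K)                         ≡⟨ m+n∸n≡m (length (dropped K)) (length K) ⟨
  length (dropped K) + length K ∸ length K   ≡⟨ cong₂ _∸_ (length-dropped+kept (idPerm n) D (crosses-sorted P)) |K| ⟩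
  length D ∸ length (reducedWord P)          ∎
  where
  open ≡-Reasoning
  D = crosses P
  K = keptCells (idPerm n) D
  dropped : List Cell → List Cell
  dropped K = filterᵇ (λ c → not (memᶜ c K)) D
  |K| : length K ≡ length (reducedWord P)
  |K| = begin
    length K                      ≡⟨ cong length (crosses-reduct P) ⟨
    length (crosses (reduct P))   ≡⟨ length-map letter (crosses (reduct P)) ⟨
    length (word (reduct P))      ≡⟨ cong length (word-reduct P) ⟩
    length (reducedWord P)        ∎

shape≡ : ∀ {n} (P : PipeDream n) → shape P ≡ wordPerm (idPerm n) (reducedWord P)
shape≡ {n} P = cong (wordPerm (idPerm n)) (word-reduct P)

reducedLetters-length : ∀ w L → length (reducedLetters w L) ≤ length L
reducedLetters-length w []      = z≤n
reducedLetters-length w (a ∷ L) with ascent w a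
... | true  = s≤s (reducedLetters-length _ L)
... | false = m≤n⇒m≤1+n (reducedLetters-length w L)

prepend-length : ∀ x r → length (prepend x r) ≤ suc (length r)
prepend-length x []       = ≤-refl
prepend-length x (y ∷ ys) with x ≡ᵇ y
... | true  = n≤1+n _
... | false = ≤-refl

collapse-length : ∀ L → length (collapse L) ≤ length L
collapse-length []      = z≤n
collapse-length (x ∷ L) = begin
  length (collapse (x ∷ L))         ≡⟨ cong length (collapse-∷ x L) ⟩
  length (prepend x (collapse L))   ≤⟨ prepend-length x (collapse L) ⟩
  suc (length (collapse L))         ≤⟨ s≤s (collapse-length L) ⟩
  suc (length L)                    ∎
  where open ≤-Reasoning

isSubword-length : ∀ S W → isSubword S W ≡ true → length S ≤ length W
isSubword-length []      W        _ = z≤n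
isSubword-length (s ∷ S) (x ∷ W) e with s ≡ᵇ x
... | true  = s≤s (isSubword-length S W e)
... | false = m≤n⇒m≤1+n (isSubword-length (s ∷ S) W e)

isSubword-refl : ∀ L → isSubword L L ≡ true
isSubword-refl []      = refl
isSubword-refl (x ∷ L) rewrite ≡ᵇ-refl x = isSubword-refl L

allVecs-complete : ∀ m (v : Vec Bool m) → v ∈ allVecs m
allVecs-complete zero    Vec.[]       = here refl
allVecs-complete (suc m) (b Vec.∷ v) =
  ∈-concat⁺′ {xss = map extend (allVecs m)} (head∈ b) (∈-map⁺ extend (allVecs-complete m v))
  where
  extend : Vec Bool m → List (Vec Bool (suc m))
  extend u = (true Vec.∷ u) ∷ (false Vec.∷ u) ∷ []
  head∈ : ∀ b → (b Vec.∷ v) ∈ extend v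
  head∈ true  = here refl
  head∈ false = there (here refl)

allPD-complete : ∀ n (P : PipeDream n) → P ∈ allPD n
allPD-complete n P = ∈-map⁺ pd (allVecs-complete (size n) (marks P))

maxFaceSize≡ : ∀ n (Q : PipeDream n) → maxFaceSize n (word Q) ≡ size n ∸ length (crosses Q)
maxFaceSize≡ n Q = ≤-antisym
  (Lₚ.foldr-preservesᵇ {P = _≤ size n ∸ length (crosses Q)} ⊔-lub z≤n (All.tabulate bounded))
  (Lₚ.foldr-preservesᵒ {P = faceSize Q ≤_} ≤-⊔ 0 _ (inj₂ (Any.map ≤-reflexive Q-face)))
  where
  faces = filterᵇ (isFace (word Q)) (allPD n)
  ≤-⊔ : ∀ a b → faceSize Q ≤ a ⊎ faceSize Q ≤ b → faceSize Q ≤ a ⊔ b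
  ≤-⊔ a b (inj₁ p) = ≤-trans p (m≤m⊔n a b)
  ≤-⊔ a b (inj₂ p) = ≤-trans p (m≤n⊔m a b)
  Q-face : faceSize Q ∈ map faceSize faces
  Q-face = ∈-map⁺ faceSize (∈-filter⁺ (T? ∘ isFace (word Q)) (allPD-complete n Q)
             (subst T (sym (isSubword-refl (word Q))) tt))
  bounded : ∀ {x} → x ∈ map faceSize faces → x ≤ size n ∸ length (crosses Q)
  bounded p with ∈-map⁻ faceSize p
  ... | R , R∈ , refl with ∈-filter⁻ (T? ∘ isFace (word Q)) {xs = allPD n} R∈
  ... | _ , t = ∸-monoʳ-≤ (size n) (subst₂ _≤_ (length-map letter (crosses Q)) (length-map letter (crosses R))
                  (isSubword-length (word Q) (word R) (Equivalence.to T-≡ t)))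

-- Glide orbits and interior faces

[m∸o]∸[n∸o]≡m∸n : ∀ m {n o} → o ≤ n → (m ∸ o) ∸ (n ∸ o) ≡ m ∸ n
[m∸o]∸[n∸o]≡m∸n m {n} {o} o≤n = trans (∸-+-assoc m o (n ∸ o)) (cong (m ∸_) (m+[n∸m]≡n o≤n))

[o∸n]∸[o∸m]≡m∸n : ∀ {m n o} → n ≤ m → m ≤ o → (o ∸ n) ∸ (o ∸ m) ≡ m ∸ n
[o∸n]∸[o∸m]≡m∸n {n = zero}              _         m≤o       = m∸[m∸n]≡n m≤o
[o∸n]∸[o∸m]≡m∸n {suc m} {suc n} {suc o} (s≤s n≤m) (s≤s m≤o) = [o∸n]∸[o∸m]≡m∸n n≤m m≤o

+m-+n≡+[m∸n] : ∀ {m n} → n ≤ m → ℤ.+ m ℤ.- ℤ.+ n ≡ ℤ.+ (m ∸ n)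
+m-+n≡+[m∸n] {m} {n} n≤m = trans (ℤ.m-n≡m⊖n m n) (ℤ.⊖-≥ n≤m)

T-does⇒ : ∀ {A : Set} (a? : Dec A) → T (does a?) → A
T-does⇒ (yes a) _ = a

map-filterᵇ-cong : ∀ {A B : Set} {p q : A → Bool} {f g : A → B} xs →
  (∀ x → p x ≡ q x) → (∀ x → T (q x) → f x ≡ g x) → map f (filterᵇ p xs) ≡ map g (filterᵇ q xs)
map-filterᵇ-cong []       _   _   = refl
map-filterᵇ-cong {p = p} {q} (x ∷ xs) p≡q f≡g with p x | q x | p≡q x | f≡g x
... | true  | true  | _ | fx≡gx = cong₂ _∷_ (fx≡gx tt) (map-filterᵇ-cong xs p≡q f≡g)
... | false | false | _ | _     = map-filterᵇ-cong xs p≡q f≡g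

QY-collapse-word : ∀ {n} (P : PipeDream n) → QuasiYamanouchi P → collapse (word P) ≡ word P
QY-collapse-word P qy =
  collapse-allSlideBlocked (crosses P) (crosses-sorted P) (crosses-InStaircase P) (QY-allSlideBlocked P qy)

QY-word-injective : ∀ {n} (P R : PipeDream n) → QuasiYamanouchi P → QuasiYamanouchi R →
  word P ≡ word R → P ≡ R
QY-word-injective P R qyP qyR e = crosses-injective P R
  (allSlideBlocked-word-injective _ _ (crosses-sorted P) (crosses-sorted R)
    (crosses-InStaircase P) (crosses-InStaircase R) (QY-allSlideBlocked P qyP) (QY-allSlideBlocked R qyR) e)

module _ {n} {w : List ℕ} (Q : PipeDream n) (shapeQ : shape Q ≡ w) (qyQ : QuasiYamanouchi Q) where

  glideOrbit⇒interior : ∀ (P : PipeDream n) → dst P ≡ Q → collapse (word P) ≡ word Q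
  glideOrbit⇒interior P dstP = begin
    collapse (word P)        ≡⟨ dst-collapse P ⟨
    collapse (word (dst P))  ≡⟨ cong (collapse ∘ word) dstP ⟩
    collapse (word Q)        ≡⟨ QY-collapse-word Q qyQ ⟩
    word Q                   ∎
    where open ≡-Reasoning

  interior⇒dst : ∀ (P : PipeDream n) → collapse (word P) ≡ word Q → dst P ≡ Q
  interior⇒dst P int = QY-word-injective (dst P) Q (dst-QY P) qyQ (begin
    word (dst P)             ≡⟨ QY-collapse-word (dst P) (dst-QY P) ⟨
    collapse (word (dst P))  ≡⟨ dst-collapse P ⟩
    collapse (word P)        ≡⟨ int ⟩
    word Q                   ∎)
    where open ≡-Reasoning

  interior-reducedWord : ∀ (P : PipeDream n) → collapse (word P) ≡ word Q → reducedWord P ≡ reducedWord Q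
  interior-reducedWord P int =
    cong (reducedLetters (idPerm n)) (trans int (sym (QY-collapse-word Q qyQ)))

  interior⇒shape : ∀ (P : PipeDream n) → collapse (word P) ≡ word Q → shape P ≡ w
  interior⇒shape P int = begin
    shape P                                 ≡⟨ shape≡ P ⟩
    wordPerm (idPerm n) (reducedWord P)     ≡⟨ cong (wordPerm (idPerm n)) (interior-reducedWord P int) ⟩
    wordPerm (idPerm n) (reducedWord Q)     ≡⟨ shape≡ Q ⟨
    shape Q                                 ≡⟨ shapeQ ⟩
    w                                       ∎
    where open ≡-Reasoning

  inGlideOrbit≡isInterior : ∀ (P : PipeDream n) → inGlideOrbit w Q P ≡ isInterior (word Q) P
  inGlideOrbit≡isInterior P with Lₚ.≡-dec _≟_ (collapse (word P)) (word Q)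
  ... | yes int rewrite dec-true (Lₚ.≡-dec _≟_ (shape P) w) (interior⇒shape P int) | interior⇒dst P int =
    Equivalence.to T-≡ (≡ᵖ?-refl Q)
  ... | no ¬int = ¬T⇒≡false (¬int ∘ glideOrbit⇒interior P ∘ ≡ᵖ?⇒≡ (dst P) Q ∘ proj₂ ∘ Equivalence.to T-∧)

  ex-difference≡codim : ∀ (P : PipeDream n) → collapse (word P) ≡ word Q →
    ℤ.+ ex P ℤ.- ℤ.+ ex Q ≡ ℤ.+ codim (word Q) P
  ex-difference≡codim P int = begin
    ℤ.+ ex P ℤ.- ℤ.+ ex Q                  ≡⟨ cong₂ (λ a b → ℤ.+ a ℤ.- ℤ.+ b) (ex≡ P) (ex≡ Q) ⟩
    ℤ.+ (p ∸ rP) ℤ.- ℤ.+ (q ∸ r)           ≡⟨ cong (λ x → ℤ.+ (p ∸ x) ℤ.- ℤ.+ (q ∸ r)) (cong length (interior-reducedWord P int)) ⟩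
    ℤ.+ (p ∸ r) ℤ.- ℤ.+ (q ∸ r)            ≡⟨ +m-+n≡+[m∸n] (∸-monoˡ-≤ r q≤p) ⟩
    ℤ.+ ((p ∸ r) ∸ (q ∸ r))                ≡⟨ cong ℤ.+_ ([m∸o]∸[n∸o]≡m∸n p r≤q) ⟩
    ℤ.+ (p ∸ q)                            ≡⟨ cong ℤ.+_ ([o∸n]∸[o∸m]≡m∸n q≤p (crosses-length P)) ⟨
    ℤ.+ ((size n ∸ q) ∸ (size n ∸ p))      ≡⟨ cong (λ x → ℤ.+ (x ∸ faceSize P)) (maxFaceSize≡ n Q) ⟨
    ℤ.+ codim (word Q) P                   ∎
    where
    open ≡-Reasoning
    p q r rP : ℕ
    p  = length (crosses P)
    q  = length (crosses Q)
    r  = length (reducedWord Q)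
    rP = length (reducedWord P)
    |word| : ∀ (R : PipeDream n) → length (word R) ≡ length (crosses R)
    |word| R = length-map letter (crosses R)
    q≤p : q ≤ p
    q≤p = subst₂ _≤_ (trans (cong length int) (|word| Q)) (|word| P) (collapse-length (word P))
    r≤q : r ≤ q
    r≤q = subst (r ≤_) (|word| Q)
            (≤-trans (reducedLetters-length (idPerm n) (collapse (word Q))) (collapse-length (word Q)))

  glide≡interiorSum : glide n w Q ≡ interiorSum n Q
  glide≡interiorSum = map-filterᵇ-cong (allPD n) inGlideOrbit≡isInterior
    (λ P t → cong (_, xExp P) (ex-difference≡codim P (T-does⇒ (Lₚ.≡-dec _≟_ (collapse (word P)) (word Q)) t)))

corollary4p10 : (n : ℕ) (w : List ℕ) (Q : PipeDream n) →
    shape Q ≡ w → QuasiYamanouchi Q →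
    glide n w Q ≈ₚ interiorSum n Q
corollary4p10 n w Q shapeQ qyQ m = cong (λ p → coeff p m) (glide≡interiorSum Q shapeQ qyQ)
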